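{- Let $\mathrm{Ax}$ be a nice axiom set, $\mathcal D$ a $\mathbf{PETS}(\mathrm{Ax})$-derivation in Variable Normal Form, and $\rho$ an assignment with $\mathrm{dom}(\rho)\cap\mathrm{bvar}(\mathcal D)=\emptyset$. Let $\kappa$ be a positive integer, $F$ a $\kappa$-model of $\mathcal D$, $\sigma$ a sequence of updates based on $F,\kappa,\mathcal D$, let $\tau$ be $\overrightarrow{\tau}_{\mathcal D}$ or $\overleftarrow{\tau}_{\mathcal D}$, and let $\langle F,\sigma',\rho'\rangle=\Phi(\tau,\langle F,\sigma,\rho\rangle)$. Then $\rho'=\rho$.
   Context: Terms over variables and a set $\mathcal F$ of function symbols with arities containing $\mathcal B=\{\epsilon,\mathrm s_0,\mathrm s_1\}$; $t[u/x]$ is substitution. A nice axiom set $\mathrm{Ax}$ consists of equations of the forms $f(\vec x)=t$, $f(\epsilon,\vec x)=t_\epsilon$, $f(\mathrm s_0(x),\vec x)=t_0$, $f(\mathrm s_1(x),\vec x)=t_1$ with $f\in\mathcal F\setminus\mathcal B$, pairwise distinct variables $x,\vec x$, right-hand sides using only displayed variables, no left-hand side repeated (also modulo substitution). $\mathbf{PETS}(\mathrm{Ax})$ rules: Axiom (substitution instances of $\mathrm{Ax}$), Reflexivity, Symmetry, Transitivity, Compatibility ($t=u\vdash s[t/x]=s[u/x]$), Substitution ($t=u\vdash t[s/x]=u[s/x]$, binding $x$). $\mathrm{var}(\mathcal D)$ = variables of $\mathcal D$, $\mathrm{bvar}(\mathcal D)$ = variables bound by some Substitution application in $\mathcal D$.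 $\mathcal D$ is in Variable Normal Form if each Axiom application's conclusion is an equation of $\mathrm{Ax}$ with variables injectively renamed to pairwise distinct variables, and every variable of $\mathcal D$ either occurs in its final equation or is bound by exactly one Substitution application. $\mathbb D$: $v::=\epsilon\mid v0\mid v1\mid*$, gauge $G(\epsilon)=G(*)=1$, $G(vi)=G(v)+1$; $\sqsubseteq$ smallest relation with $*\sqsubseteq v$, $\epsilon\sqsubseteq\epsilon$, $v\sqsubseteq w\Rightarrow vi\sqsubseteq wi$. Consistent sets are finite sets of generators $\vec u\mapsto v$ ($v\ne *$), componentwise-comparable arguments giving comparable values, defining $\hat f(\vec x)$ = greatest $v$ with $\vec w\sqsubseteq\vec x$, $\vec w\mapsto v\in\hat f$ ($*$ if none). A frame $F$ maps finitely many $f\in\mathcal F\setminus\mathcal B$ to consistent sets ($\emptyset$ otherwise); $F(f)(\vec v)=f(\vec v)$ for basic $f$, $\hat f(\vec v)$ otherwise; $G(F)$ = max gauge of generator components. An assignment is a finite partial map $\rho$ from variables to $\mathbb D$, $\rho(x)=*$ outside the domain, $\rho[x\mapsto v]$ modifies it at $x$. Evaluation $[\![x]\!]_{F,\rho}=\rho(x)$, $[\![f(\vec t)]\!]_{F,\rho}=F(f)([\![t_1]\!]_{F,\rho},\dots)$. $F$ is a $\kappa$-model of $\mathcal D$ if $G(F)\le\kappa$ and $[\![t]\!]_{F,\rho}\sqsubseteq[\![u]\!]_{F,\rho}$ for all equations $t=u$ of $\mathrm{Ax}$ occurring in $\mathcal D$ and assignments with $\mathrm{dom}(\rho)\subseteq\mathrm{var}(\mathcal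 D)$, $G(\rho)\le\kappa$. An update based on $F,\kappa,\mathcal D$ is $f{:}\vec v\mapsto w$ ($\vec v\mapsto w$ a generator of gauge $\le\kappa$) such that for some equation $f(t_1..t_n)=u$ of $\mathrm{Ax}$ occurring in $\mathcal D$ and assignment $\rho$: $v_i=\rho(t_i)$, $w=[\![u]\!]_{F,\rho}$; $F*(f{:}\vec v\mapsto w)$ adds $\vec v\mapsto w$ to $F(f)$; a sequence of updates $\sigma=\langle\nu_1..\nu_\ell\rangle$ requires each $\nu_{i+1}$ to be an update based on $F*\langle\nu_1..\nu_i\rangle,\kappa,\mathcal D$, and $F*\sigma$ applies them in order. Instructions: $\mathrm A[t\to u]$, $\mathrm A[t\leftarrow u]$, $\mathrm S{\uparrow}[s,t/x]$, $\mathrm S{\downarrow}[s,t/x]$. $\overrightarrow{\tau}_{\mathcal D},\overleftarrow{\tau}_{\mathcal D}$ are defined by recursion on $\mathcal D$ (":" adds an element at an end, "::" concatenates): Axiom $\vdash t=u$: $\langle\mathrm A[t\to u]\rangle$, $\langle\mathrm A[t\leftarrow u]\rangle$; Reflexivity: both empty; Symmetry from $\mathcal D_1$: swap, $\overrightarrow\tau_{\mathcal D}=\overleftarrow\tau_{\mathcal D_1}$, $\overleftarrow\tau_{\mathcal D}=\overrightarrow\tau_{\mathcal D_1}$; Transitivity from $\mathcal D_1\vdash t=s$, $\mathcal D_2\vdash s=u$: $\overrightarrow\tau_{\mathcal D_1}::\overrightarrow\tau_{\mathcal D_2}$ and $\overleftarrow\tau_{\mathcal D_2}::\overleftarrow\tau_{\mathcal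 D_1}$; Compatibility from $\mathcal D_1$: same as $\mathcal D_1$; Substitution from $\mathcal D_1\vdash t=u$ to $t[s/x]=u[s/x]$: $\overrightarrow\tau_{\mathcal D}=\mathrm S{\uparrow}[t,s/x]:\overrightarrow\tau_{\mathcal D_1}:\mathrm S{\downarrow}[u,s/x]$ and $\overleftarrow\tau_{\mathcal D}=\mathrm S{\uparrow}[u,s/x]:\overleftarrow\tau_{\mathcal D_1}:\mathrm S{\downarrow}[t,s/x]$. $\Psi(t\leftarrow u,\langle F,\rho\rangle)$ for $t=f(t_1..t_n)$ is $f{:}\vec v\mapsto w$ with $v_i=\rho(t_i)$, $w=[\![u]\!]_{F,\rho}$. $\Phi(\tau,\langle F,\sigma,\rho\rangle)$ by recursion on $\tau$: empty $\tau$ returns the input; for $\tau'$ followed by $I$, with $\langle F,\sigma',\rho'\rangle=\Phi(\tau',\cdot)$, $F'=F*\sigma'$: $\mathrm A[t\to u]$ gives $\langle F,\sigma',\rho'\rangle$; $\mathrm A[t\leftarrow u]$ gives $\langle F,\sigma'$ extended at the end by $\Psi(t\leftarrow u,\langle F',\rho'\rangle),\rho'\rangle$; $\mathrm S{\uparrow}[t,s/x]$ gives $\langle F,\sigma',\rho'[x\mapsto[\![s]\!]_{F',\rho'}]\rangle$; $\mathrm S{\downarrow}[t,s/x]$ gives $\langle F,\sigma',\rho'$ restricted to $\mathrm{dom}(\rho')\setminus\{x\}\rangle$. -}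

module Defs where

open import Data.Nat using (ℕ; zero; suc; _⊔_; _≤_; _≟_; _≡ᵇ_)
open import Data.Bool using (Bool; true; false; not; if_then_else_)
open import Data.Fin using (Fin)
open import Data.Maybe using (Maybe; just; nothing; fromMaybe)
open import Data.Product using (Σ; _×_; _,_; proj₁; proj₂)
open import Data.Sum using (_⊎_)
open import Data.Unit using (⊤)
open import Data.Empty using (⊥)
open import Data.List using (List; []; _∷_; _++_; _∷ʳ_; length; lookup; foldr; foldl; filter; map)
open import Data.List.Membership.Propositional using (_∈_)
open import Data.Vec as V using (Vec; []; _∷_)
open import Data.Vec.Membership.Propositional using () renaming (_∈_ to _∈V_)
open import Data.Vec.Relation.Unary.Unique.Propositional using () renaming (Unique to UniqueV)
open import Relation.Nullary using (¬_; Dec; yes; no; does)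
open import Relation.Nullary.Decidable using (¬?)
open import Relation.Binary.PropositionalEquality using (_≡_; _≢_; refl)

data FSym : Set where
  eps s0 s1 : FSym
  fn        : (k n : ℕ) → FSym

arity : FSym → ℕ
arity eps      = 0
arity s0       = 1
arity s1       = 1
arity (fn k n) = n

data Term : Set where
  var : ℕ → Term
  app : (f : FSym) → Vec Term (arity f) → Term

Eqn : Set
Eqn = Term × Term

mutual
  vars : Term → List ℕ
  vars (var x)    = x ∷ []
  vars (app f ts) = varsV ts

  varsV : ∀ {n} → Vec Term n → List ℕ
  varsV []       = []
  varsV (t ∷ ts) = vars t ++ varsV ts

varsEq : Eqn → List ℕ
varsEq (t , u) = vars t ++ vars u

mutual
  sub : (ℕ → Term) → Term → Term
  sub θ (var x)    = θ x
  sub θ (app f ts) = app f (subV θ ts)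

  subV : ∀ {n} → (ℕ → Term) → Vec Term n → Vec Term n
  subV θ []       = []
  subV θ (t ∷ ts) = sub θ t ∷ subV θ ts

_[_/_] : Term → Term → ℕ → Term
t [ s / x ] = sub (λ y → if y ≡ᵇ x then s else var y) t

data NiceEq : Term → Term → Set where
  plain : ∀ {k n} (xs : Vec ℕ n) (t : Term) → UniqueV xs →
          (∀ y → y ∈ vars t → y ∈V xs) →
          NiceEq (app (fn k n) (V.map var xs)) t
  caseε : ∀ {k n} (xs : Vec ℕ n) (t : Term) → UniqueV xs →
          (∀ y → y ∈ vars t → y ∈V xs) →
          NiceEq (app (fn k (suc n)) (app eps [] ∷ V.map var xs)) t
  case0 : ∀ {k n} (x : ℕ) (xs : Vec ℕ n) (t : Term) → UniqueV (x ∷ xs) →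
          (∀ y → y ∈ vars t → y ∈V (x ∷ xs)) →
          NiceEq (app (fn k (suc n)) (app s0 (var x ∷ []) ∷ V.map var xs)) t
  case1 : ∀ {k n} (x : ℕ) (xs : Vec ℕ n) (t : Term) → UniqueV (x ∷ xs) →
          (∀ y → y ∈ vars t → y ∈V (x ∷ xs)) →
          NiceEq (app (fn k (suc n)) (app s1 (var x ∷ []) ∷ V.map var xs)) t

Nice : List Eqn → Set
Nice Ax =
  (∀ i → NiceEq (proj₁ (lookup Ax i)) (proj₂ (lookup Ax i))) ×
  (∀ i j → i ≢ j → ¬ Σ (ℕ → Term) λ θ →
     proj₁ (lookup Ax j) ≡ sub θ (proj₁ (lookup Ax i)))

data Deriv (Ax : List Eqn) : Term → Term → Set where
  rAxiom : (i : Fin (length Ax)) (θ : ℕ → Term) →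
          Deriv Ax (sub θ (proj₁ (lookup Ax i))) (sub θ (proj₂ (lookup Ax i)))
  rRefl  : (t : Term) → Deriv Ax t t
  rSym   : ∀ {t u} → Deriv Ax t u → Deriv Ax u t
  rTrans : ∀ {t s u} → Deriv Ax t s → Deriv Ax s u → Deriv Ax t u
  rComp  : ∀ {t u} (s : Term) (x : ℕ) → Deriv Ax t u →
          Deriv Ax (s [ t / x ]) (s [ u / x ])
  rSubst : ∀ {t u} (s : Term) (x : ℕ) → Deriv Ax t u →
          Deriv Ax (t [ s / x ]) (u [ s / x ])

module _ {Ax : List Eqn} where

  varD : ∀ {t u} → Deriv Ax t u → List ℕ
  varD {t} {u} (rAxiom i θ)   = vars t ++ vars u
  varD {t} {u} (rRefl _)      = vars t ++ vars u
  varD {t} {u} (rSym d)       = vars t ++ vars u ++ varD d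
  varD {t} {u} (rTrans d e)   = vars t ++ vars u ++ varD d ++ varD e
  varD {t} {u} (rComp s x d)  = vars t ++ vars u ++ varD d
  varD {t} {u} (rSubst s x d) = vars t ++ vars u ++ varD d

  -- bvar(D), listed with one entry per Substitution application
  bvarL : ∀ {t u} → Deriv Ax t u → List ℕ
  bvarL (rAxiom i θ)   = []
  bvarL (rRefl _)      = []
  bvarL (rSym d)       = bvarL d
  bvarL (rTrans d e)   = bvarL d ++ bvarL e
  bvarL (rComp s x d)  = bvarL d
  bvarL (rSubst s x d) = x ∷ bvarL d

  axEqs : ∀ {t u} → Deriv Ax t u → List Eqn
  axEqs {t} {u} (rAxiom i θ) = (t , u) ∷ []
  axEqs (rRefl _)      = []
  axEqs (rSym d)       = axEqs d
  axEqs (rTrans d e)   = axEqs d ++ axEqs e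
  axEqs (rComp s x d)  = axEqs d
  axEqs (rSubst s x d) = axEqs d

  AxRenamed : ∀ {t u} → Deriv Ax t u → Set
  AxRenamed (rAxiom i θ) =
    Σ (ℕ → ℕ) λ r →
      (∀ y z → y ∈ varsEq (lookup Ax i) → z ∈ varsEq (lookup Ax i) →
         r y ≡ r z → y ≡ z) ×
      (sub θ (proj₁ (lookup Ax i)) ≡ sub (λ y → var (r y)) (proj₁ (lookup Ax i))) ×
      (sub θ (proj₂ (lookup Ax i)) ≡ sub (λ y → var (r y)) (proj₂ (lookup Ax i)))
  AxRenamed (rRefl _)      = ⊤
  AxRenamed (rSym d)       = AxRenamed d
  AxRenamed (rTrans d e)   = AxRenamed d × AxRenamed e
  AxRenamed (rComp s x d)  = AxRenamed d
  AxRenamed (rSubst s x d) = AxRenamed d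

count : ℕ → List ℕ → ℕ
count x []       = 0
count x (y ∷ ys) = if y ≡ᵇ x then suc (count x ys) else count x ys

VNF : ∀ {Ax t u} → Deriv Ax t u → Set
VNF {Ax} {t} {u} D =
  AxRenamed D ×
  (∀ y → y ∈ varD D → (y ∈ varsEq (t , u)) ⊎ (count y (bvarL D) ≡ 1))

infixl 8 _·0 _·1
data Val : Set where
  εv  : Val
  _·0 : Val → Val
  _·1 : Val → Val
  ⋆   : Val

gauge : Val → ℕ
gauge εv     = 1
gauge ⋆      = 1
gauge (v ·0) = suc (gauge v)
gauge (v ·1) = suc (gauge v)

infix 4 _⊑_
data _⊑_ : Val → Val → Set where
  ⋆⊑  : ∀ {v} → ⋆ ⊑ v
  ε⊑ε : εv ⊑ εv
  ⊑0  : ∀ {v w} → v ⊑ w → v ·0 ⊑ w ·0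
  ⊑1  : ∀ {v w} → v ⊑ w → v ·1 ⊑ w ·1

_⊑?_ : (v w : Val) → Dec (v ⊑ w)
⋆ ⊑? w = yes ⋆⊑
εv ⊑? εv = yes ε⊑ε
εv ⊑? (w ·0) = no λ ()
εv ⊑? (w ·1) = no λ ()
εv ⊑? ⋆ = no λ ()
(v ·0) ⊑? (w ·0) with v ⊑? w
... | yes p = yes (⊑0 p)
... | no ¬p = no λ { (⊑0 p) → ¬p p }
(v ·0) ⊑? εv = no λ ()
(v ·0) ⊑? (w ·1) = no λ ()
(v ·0) ⊑? ⋆ = no λ ()
(v ·1) ⊑? (w ·1) with v ⊑? w
... | yes p = yes (⊑1 p)
... | no ¬p = no λ { (⊑1 p) → ¬p p }
(v ·1) ⊑? εv = no λ ()
(v ·1) ⊑? (w ·0) = no λ ()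
(v ·1) ⊑? ⋆ = no λ ()

data _⊑*_ : ∀ {n} → Vec Val n → Vec Val n → Set where
  []  : [] ⊑* []
  _∷_ : ∀ {n v w} {vs ws : Vec Val n} → v ⊑ w → vs ⊑* ws → (v ∷ vs) ⊑* (w ∷ ws)

_⊑*?_ : ∀ {n} (vs ws : Vec Val n) → Dec (vs ⊑* ws)
[] ⊑*? [] = yes []
(v ∷ vs) ⊑*? (w ∷ ws) with v ⊑? w | vs ⊑*? ws
... | yes p | yes ps = yes (p ∷ ps)
... | no ¬p | _      = no λ { (p ∷ _) → ¬p p }
... | yes _ | no ¬ps = no λ { (_ ∷ ps) → ¬ps ps }

Comparable : Val → Val → Set
Comparable v w = (v ⊑ w) ⊎ (w ⊑ v)

data Comparable* : ∀ {n} → Vec Val n → Vec Val n → Set where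
  []  : Comparable* [] []
  _∷_ : ∀ {n v w} {vs ws : Vec Val n} → Comparable v w → Comparable* vs ws →
        Comparable* (v ∷ vs) (w ∷ ws)

-- Frames: a frame is the finite list of its generators, each tagged with
-- the non-basic symbol  fn k n  it belongs to.  F(fn k n) is the set of
-- generators tagged with (k , n).

record Gen : Set where
  constructor gen
  field
    name  : ℕ
    ar    : ℕ
    args  : Vec Val ar
    value : Val
open Gen public

Frame : Set
Frame = List Gen

gaugeGen : Gen → ℕ
gaugeGen g = V.foldr _ _⊔_ (gauge (value g)) (V.map gauge (args g))

gaugeFrame : Frame → ℕ
gaugeFrame F = foldr _⊔_ 0 (map gaugeGen F)

IsFrame : Frame → Set
IsFrame F =
  (∀ g → g ∈ F → value g ≢ ⋆) ×
  (∀ {k n} (a a' : Vec Val n) (v v' : Val) →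
     gen k n a v ∈ F → gen k n a' v' ∈ F → Comparable* a a' → Comparable v v')

max⊑ : Val → Val → Val
max⊑ v w with v ⊑? w
... | yes _ = w
... | no  _ = v

-- For a consistent set these values
-- form a chain, so the fold with max⊑ computes the greatest one.
hat : Frame → (k n : ℕ) → Vec Val n → Val
hat []                   k n xs = ⋆
hat (gen k' n' a v ∷ F) k n xs with k' ≟ k | n' ≟ n
... | yes refl | yes refl with a ⊑*? xs
...   | yes _ = max⊑ v (hat F k n xs)
...   | no  _ = hat F k n xs
hat (gen k' n' a v ∷ F) k n xs | _ | _ = hat F k n xs

-- Assignments: finite partial maps, represented as association lists
-- (the first binding of a variable counts).

Assign : Set
Assign = List (ℕ × Val)

lookupA : Assign → ℕ → Maybe Val
lookupA []             x = nothing
lookupA ((y , v) ∷ ρ)  x = if y ≡ᵇ x then just v else lookupA ρ x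

_⟨_⟩ : Assign → ℕ → Val
ρ ⟨ x ⟩ = fromMaybe ⋆ (lookupA ρ x)

_[_↦_] : Assign → ℕ → Val → Assign
ρ [ x ↦ v ] = (x , v) ∷ ρ

_∖_ : Assign → ℕ → Assign
ρ ∖ x = filter (λ p → ¬? (proj₁ p ≟ x)) ρ

InDom : Assign → ℕ → Set
InDom ρ x = lookupA ρ x ≢ nothing

gaugeAssign≤ : Assign → ℕ → Set
gaugeAssign≤ ρ κ = ∀ x v → lookupA ρ x ≡ just v → gauge v ≤ κ

mutual
  eval : Frame → Assign → Term → Val
  eval F ρ (var x)               = ρ ⟨ x ⟩
  eval F ρ (app eps [])          = εv
  eval F ρ (app s0 (t ∷ []))     = eval F ρ t ·0
  eval F ρ (app s1 (t ∷ []))     = eval F ρ t ·1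
  eval F ρ (app (fn k n) ts)     = hat F k n (evalV F ρ ts)

  evalV : ∀ {n} → Frame → Assign → Vec Term n → Vec Val n
  evalV F ρ []       = []
  evalV F ρ (t ∷ ts) = eval F ρ t ∷ evalV F ρ ts

IsModel : ∀ {Ax t u} → ℕ → Frame → Deriv Ax t u → Set
IsModel κ F D =
  IsFrame F × gaugeFrame F ≤ κ ×
  (∀ t u → (t , u) ∈ axEqs D → ∀ (ρ : Assign) →
     (∀ x → InDom ρ x → x ∈ varD D) → gaugeAssign≤ ρ κ →
     eval F ρ t ⊑ eval F ρ u)

_*_ : Frame → List Gen → Frame
F * σ = F ++ σ

IsUpdate : ∀ {Ax t u} → Frame → ℕ → Deriv Ax t u → Gen → Set
IsUpdate F κ D (gen k n vs w) =
  w ≢ ⋆ × gaugeGen (gen k n vs w) ≤ κ ×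
  Σ (Vec Term n) λ ts → Σ Term λ u →
    (app (fn k n) ts , u) ∈ axEqs D ×
    Σ Assign λ ρ → vs ≡ evalV F ρ ts × w ≡ eval F ρ u

IsUpdateSeq : ∀ {Ax t u} → Frame → ℕ → Deriv Ax t u → List Gen → Set
IsUpdateSeq F κ D []      = ⊤
IsUpdateSeq F κ D (ν ∷ σ) = IsUpdate F κ D ν × IsUpdateSeq (F * (ν ∷ [])) κ D σ

data Instr : Set where
  A→ A← : Term → Term → Instr
  S↑ S↓ : Term → Term → ℕ → Instr

mutual
  τ→ : ∀ {Ax t u} → Deriv Ax t u → List Instr
  τ→ {t = t} {u} (rAxiom i θ) = A→ t u ∷ []
  τ→ (rRefl _)                = []
  τ→ (rSym d)                 = τ← d
  τ→ (rTrans d e)             = τ→ d ++ τ→ e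
  τ→ (rComp s x d)            = τ→ d
  τ→ (rSubst {t} {u} s x d)   = (S↑ t s x ∷ τ→ d) ∷ʳ S↓ u s x

  τ← : ∀ {Ax t u} → Deriv Ax t u → List Instr
  τ← {t = t} {u} (rAxiom i θ) = A← t u ∷ []
  τ← (rRefl _)                = []
  τ← (rSym d)                 = τ→ d
  τ← (rTrans d e)             = τ← e ++ τ← d
  τ← (rComp s x d)            = τ← d
  τ← (rSubst {t} {u} s x d)   = (S↑ u s x ∷ τ← d) ∷ʳ S↓ t s x

-- Ψ(t ← u, ⟨F, ρ⟩) for t = f(t₁..tₙ); given as a list with at most one
-- element (empty when t is not headed by a non-basic symbol, a case that
-- never arises for derivations in Variable Normal Form).
Ψ : Term → Term → Frame → Assign → List Gen
Ψ (app (fn k n) ts) u F ρ = gen k n (evalV F ρ ts) (eval F ρ u) ∷ []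
Ψ _                 u F ρ = []

State : Set
State = Frame × List Gen × Assign

step : State → Instr → State
step (F , σ' , ρ') (A→ t u)   = F , σ' , ρ'
step (F , σ' , ρ') (A← t u)   = F , σ' ++ Ψ t u (F * σ') ρ' , ρ'
step (F , σ' , ρ') (S↑ t s x) = F , σ' , ρ' [ x ↦ eval (F * σ') ρ' s ]
step (F , σ' , ρ') (S↓ t s x) = F , σ' , ρ' ∖ x

Φ : List Instr → State → State
Φ τ st = foldl step st τ

-- Only the brackets S↑[_, s/x] … S↓[_, s/x] around the trace of a
-- Substitution step touch the assignment: they bind x, run the inner trace,
-- and then delete x.  Hence, by induction on the derivation, running either
-- trace can only delete bindings of variables in bvar(D) — also when a
-- variable is bound twice — and ρ has no such bindings.
module Submission where

open import Defs
open import Data.Nat using (ℕ; _≤_; _≟_)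
open import Data.List using (List; []; _∷_; _++_; _∷ʳ_)
open import Data.List.Properties using (foldl-++; foldl-∷ʳ; filter-accept; filter-reject)
open import Data.List.Membership.Propositional using (_∈_)
open import Data.List.Relation.Binary.Subset.Propositional using (_⊆_)
open import Data.List.Relation.Binary.Subset.Propositional.Properties using (xs⊆xs++ys; xs⊆ys++xs)
open import Data.List.Relation.Unary.Any using (here; there)
open import Data.Maybe using (just; nothing)
open import Data.Product using (proj₁; proj₂; _,_; _×_; swap)
open import Data.Sum using (_⊎_; inj₁; inj₂)
open import Relation.Nullary using (yes; no)
open import Relation.Nullary.Decidable using (¬?; dec-true; dec-false)
open import Relation.Binary.PropositionalEquality using (_≡_; _≢_; refl; sym; trans; cong; subst)

lookupA-[↦]-≡ : ∀ ρ x (v : Val) → lookupA (ρ [ x ↦ v ]) x ≡ just v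
lookupA-[↦]-≡ ρ x v rewrite dec-true (x ≟ x) refl = refl

lookupA-[↦]-≢ : ∀ ρ {x y} (v : Val) → x ≢ y → lookupA (ρ [ x ↦ v ]) y ≡ lookupA ρ y
lookupA-[↦]-≢ ρ {x} {y} v x≢y rewrite dec-false (x ≟ y) x≢y = refl

∖-[↦]-≡ : ∀ ρ x (v : Val) → (ρ [ x ↦ v ]) ∖ x ≡ ρ ∖ x
∖-[↦]-≡ ρ x v = filter-reject (λ p → ¬? (proj₁ p ≟ x)) (λ x≢x → x≢x refl)

∖-[↦]-≢ : ∀ ρ {x z} (v : Val) → z ≢ x → (ρ [ z ↦ v ]) ∖ x ≡ (ρ ∖ x) [ z ↦ v ]
∖-[↦]-≢ ρ {x} v z≢x = filter-accept (λ p → ¬? (proj₁ p ≟ x)) z≢x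

lookupA-∖-≡ : ∀ ρ x → lookupA (ρ ∖ x) x ≡ nothing
lookupA-∖-≡ []            x = refl
lookupA-∖-≡ ((z , v) ∷ ρ) x with z ≟ x
... | yes refl rewrite ∖-[↦]-≡ ρ z v = lookupA-∖-≡ ρ z
... | no z≢x rewrite ∖-[↦]-≢ ρ v z≢x =
  trans (lookupA-[↦]-≢ (ρ ∖ x) v z≢x) (lookupA-∖-≡ ρ x)

lookupA-∖-≢ : ∀ ρ {x y} → y ≢ x → lookupA (ρ ∖ x) y ≡ lookupA ρ y
lookupA-∖-≢ []            y≢x = refl
lookupA-∖-≢ ((z , v) ∷ ρ) {x} {y} y≢x with z ≟ x
... | yes refl rewrite ∖-[↦]-≡ ρ z v =
  trans (lookupA-∖-≢ ρ y≢x) (sym (lookupA-[↦]-≢ ρ v (λ z≡y → y≢x (sym z≡y))))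
... | no z≢x rewrite ∖-[↦]-≢ ρ v z≢x with z ≟ y
...   | yes refl = trans (lookupA-[↦]-≡ (ρ ∖ x) z v) (sym (lookupA-[↦]-≡ ρ z v))
...   | no z≢y = trans (lookupA-[↦]-≢ (ρ ∖ x) v z≢y)
                       (trans (lookupA-∖-≢ ρ y≢x) (sym (lookupA-[↦]-≢ ρ v z≢y)))

record Forgets (bs : List ℕ) (ρ ρ' : Assign) : Set where
  field
    forgets-at : ∀ y → lookupA ρ' y ≡ lookupA ρ y ⊎ (y ∈ bs × lookupA ρ' y ≡ nothing)
open Forgets

Forgets-refl : ∀ {bs ρ} → Forgets bs ρ ρ
forgets-at Forgets-refl y = inj₁ refl

Forgets-trans : ∀ {bs ρ ρ' ρ''} → Forgets bs ρ ρ' → Forgets bs ρ' ρ'' → Forgets bs ρ ρ''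
forgets-at (Forgets-trans ρ⊒ρ' ρ'⊒ρ'') y with forgets-at ρ'⊒ρ'' y
... | inj₂ forgotten = inj₂ forgotten
... | inj₁ ρ''y≡ρ'y with forgets-at ρ⊒ρ' y
...   | inj₁ ρ'y≡ρy               = inj₁ (trans ρ''y≡ρ'y ρ'y≡ρy)
...   | inj₂ (y∈bs , ρ'y≡nothing) = inj₂ (y∈bs , trans ρ''y≡ρ'y ρ'y≡nothing)

Forgets-mono : ∀ {bs bs' ρ ρ'} → bs ⊆ bs' → Forgets bs ρ ρ' → Forgets bs' ρ ρ'
forgets-at (Forgets-mono bs⊆bs' ρ⊒ρ') y with forgets-at ρ⊒ρ' y
... | inj₁ unchanged             = inj₁ unchanged
... | inj₂ (y∈bs , ρ'y≡nothing) = inj₂ (bs⊆bs' y∈bs , ρ'y≡nothing)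

Forgets-[↦]-∖ : ∀ {bs ρ' ρ x v} → Forgets bs (ρ [ x ↦ v ]) ρ' → Forgets (x ∷ bs) ρ (ρ' ∖ x)
forgets-at (Forgets-[↦]-∖ {ρ' = ρ'} {ρ} {x} {v} ρx⊒ρ') y with y ≟ x
... | yes refl = inj₂ (here refl , lookupA-∖-≡ ρ' y)
... | no y≢x with forgets-at ρx⊒ρ' y
...   | inj₁ ρ'y≡ρxy =
  inj₁ (trans (lookupA-∖-≢ ρ' y≢x) (trans ρ'y≡ρxy (lookupA-[↦]-≢ ρ v (λ x≡y → y≢x (sym x≡y)))))
...   | inj₂ (y∈bs , ρ'y≡nothing) = inj₂ (there y∈bs , trans (lookupA-∖-≢ ρ' y≢x) ρ'y≡nothing)

Forgets-unbound : ∀ {bs ρ ρ'} → (∀ y → y ∈ bs → lookupA ρ y ≡ nothing) →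
  Forgets bs ρ ρ' → ∀ y → lookupA ρ' y ≡ lookupA ρ y
Forgets-unbound unbound ρ⊒ρ' y with forgets-at ρ⊒ρ' y
... | inj₁ unchanged             = unchanged
... | inj₂ (y∈bs , ρ'y≡nothing) = trans ρ'y≡nothing (sym (unbound y y∈bs))

assignment : State → Assign
assignment (_ , _ , ρ) = ρ

OnlyForgets : List ℕ → List Instr → Set
OnlyForgets bs τ = ∀ st → Forgets bs (assignment st) (assignment (Φ τ st))

OnlyForgets-[] : ∀ {bs} → OnlyForgets bs []
OnlyForgets-[] st = Forgets-refl

OnlyForgets-mono : ∀ {bs bs' τ} → bs ⊆ bs' → OnlyForgets bs τ → OnlyForgets bs' τ
OnlyForgets-mono bs⊆bs' τ-forgets st = Forgets-mono bs⊆bs' (τ-forgets st)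

OnlyForgets-++ : ∀ {bs} τ₁ {τ₂} → OnlyForgets bs τ₁ → OnlyForgets bs τ₂ → OnlyForgets bs (τ₁ ++ τ₂)
OnlyForgets-++ τ₁ {τ₂} τ₁-forgets τ₂-forgets st =
  subst (Forgets _ (assignment st)) (sym (cong assignment (foldl-++ step st τ₁ τ₂)))
    (Forgets-trans (τ₁-forgets st) (τ₂-forgets (Φ τ₁ st)))

OnlyForgets-bind : ∀ {bs} τ t u s x →
  OnlyForgets bs τ → OnlyForgets (x ∷ bs) ((S↑ t s x ∷ τ) ∷ʳ S↓ u s x)
OnlyForgets-bind τ t u s x τ-forgets st@(_ , _ , ρ) =
  subst (Forgets _ ρ) (sym (cong assignment (foldl-∷ʳ step (step st (S↑ t s x)) (S↓ u s x) τ)))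
    (Forgets-[↦]-∖ (τ-forgets (step st (S↑ t s x))))

traces-only-forget : ∀ {Ax t u} (D : Deriv Ax t u) →
  OnlyForgets (bvarL D) (τ→ D) × OnlyForgets (bvarL D) (τ← D)
traces-only-forget (rAxiom i θ) = OnlyForgets-[] , OnlyForgets-[]
traces-only-forget (rRefl _)    = OnlyForgets-[] , OnlyForgets-[]
traces-only-forget (rSym d)     = swap (traces-only-forget d)
traces-only-forget (rTrans d e) with traces-only-forget d | traces-only-forget e
... | d→ , d← | e→ , e← =
  OnlyForgets-++ (τ→ d) (weakenˡ (τ→ d) d→) (weakenʳ (τ→ e) e→) ,
  OnlyForgets-++ (τ← e) (weakenʳ (τ← e) e←) (weakenˡ (τ← d) d←)
  where
  weakenˡ : ∀ τ → OnlyForgets (bvarL d) τ → OnlyForgets (bvarL d ++ bvarL e) τ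
  weakenˡ τ = OnlyForgets-mono {τ = τ} (xs⊆xs++ys (bvarL d) (bvarL e))
  weakenʳ : ∀ τ → OnlyForgets (bvarL e) τ → OnlyForgets (bvarL d ++ bvarL e) τ
  weakenʳ τ = OnlyForgets-mono {τ = τ} (xs⊆ys++xs (bvarL e) (bvarL d))
traces-only-forget (rComp s x d) = traces-only-forget d
traces-only-forget (rSubst {t} {u} s x d) =
  OnlyForgets-bind (τ→ d) t u s x (proj₁ (traces-only-forget d)) ,
  OnlyForgets-bind (τ← d) u t s x (proj₂ (traces-only-forget d))

lemma8p1 : (Ax : List Eqn) → Nice Ax →
    ∀ {t u} (D : Deriv Ax t u) → VNF D →
    (ρ : Assign) → (∀ x → x ∈ bvarL D → lookupA ρ x ≡ nothing) →
    (κ : ℕ) → 1 ≤ κ →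
    (F : Frame) → IsModel κ F D →
    (σ : List Gen) → IsUpdateSeq F κ D σ →
    (τ : List Instr) → (τ ≡ τ→ D) ⊎ (τ ≡ τ← D) →
    ∀ x → lookupA (proj₂ (proj₂ (Φ τ (F , σ , ρ)))) x ≡ lookupA ρ x
lemma8p1 _ _ D _ ρ ρ-unbound _ _ F _ σ _ τ τ-trace =
  Forgets-unbound ρ-unbound (τ-only-forgets τ-trace (F , σ , ρ))
  where
  τ-only-forgets : (τ ≡ τ→ D) ⊎ (τ ≡ τ← D) → OnlyForgets (bvarL D) τ
  τ-only-forgets (inj₁ refl) = proj₁ (traces-only-forget D)
  τ-only-forgets (inj₂ refl) = proj₂ (traces-only-forget D)
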